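{- For all even integers $m, n \ge 4$ there exists a planar point-conic configuration of type $\bigl((2mn)_6\bigr)$, i.e. a set of $2mn$ points and $2mn$ non-degenerate conics in the plane such that each of the points lies on exactly $6$ of the conics and each of the conics passes through exactly $6$ of the points.
   Context: A (geometric) point-conic configuration of type $(n_k)$ is a family of $n$ points and $n$ non-degenerate conics in the real plane such that each point is incident with precisely $k$ of the conics and each conic is incident with precisely $k$ of the points (only the configuration points are counted). -}

module Defs where

open import Level using (0ℓ)
open import Data.Nat using (ℕ)
open import Data.Fin using (Fin)
open import Data.Product using (Σ; ∃; _×_; _,_)
open import Data.Sum using (_⊎_)
open import Function using (_⇔_)
open import Function.Definitions using (Injective)
open import Relation.Binary.PropositionalEquality using (_≡_; _≢_)
open import Relation.Binary.Definitions using (Trichotomous)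
open import Relation.Nullary using (¬_)
open import Algebra.Structures using (IsCommutativeRing)

-- The real numbers, axiomatised as a Dedekind-complete ordered field.
-- (Any two such structures are isomorphic, so quantifying over all of
-- them is the same as speaking about ℝ.)

record RealField : Set₁ where
  infixl 6 _+_
  infixl 7 _*_
  infix 4 _<_ _≤_
  field
    Carrier : Set
    _+_ _*_ : Carrier → Carrier → Carrier
    -_ : Carrier → Carrier
    0# 1# : Carrier
    _⁻¹ : Carrier → Carrier
    _<_ : Carrier → Carrier → Set
    isCommutativeRing : IsCommutativeRing _≡_ _+_ _*_ -_ 0# 1#
    0≢1 : 0# ≢ 1#
    ⁻¹-inverse : ∀ x → x ≢ 0# → x * (x ⁻¹) ≡ 1#
    <-trans : ∀ {x y z} → x < y → y < z → x < z
    <-tri : Trichotomous _≡_ _<_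
    +-mono-< : ∀ {x y} z → x < y → x + z < y + z
    *-pos : ∀ {x y} → 0# < x → 0# < y → 0# < x * y

  _≤_ : Carrier → Carrier → Set
  x ≤ y = x < y ⊎ x ≡ y

  field
    complete : (P : Carrier → Set) → (∃ λ x → P x) →
               (∃ λ b → ∀ x → P x → x ≤ b) →
               ∃ λ s → (∀ x → P x → x ≤ s) ×
                       (∀ b → (∀ x → P x → x ≤ b) → s ≤ b)

module _ (R : RealField) where
  open RealField R

  Point : Set
  Point = Carrier × Carrier

  record Conic : Set where
    constructor mkConic
    field a b c d e f : Carrier

  2× : Carrier → Carrier
  2× x = x + x

  det3 : Carrier → Carrier → Carrier → Carrier → Carrier → Carrier →
         Carrier → Carrier → Carrier → Carrier
  det3 a11 a12 a13 a21 a22 a23 a31 a32 a33 =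
    a11 * (a22 * a33 + - (a23 * a32))
    + - (a12 * (a21 * a33 + - (a23 * a31)))
    + a13 * (a21 * a32 + - (a22 * a31))

  NonDegenerate : Conic → Set
  NonDegenerate (mkConic a b c d e f) =
    det3 (2× a) b d b (2× c) e d e (2× f) ≢ 0#

  _lies-on_ : Point → Conic → Set
  (x , y) lies-on (mkConic a b c d e f) =
    a * x * x + b * x * y + c * y * y + d * x + e * y + f ≡ 0#

  SameConic : Conic → Conic → Set
  SameConic (mkConic a b c d e f) (mkConic a' b' c' d' e' f') =
    Σ Carrier λ t → t ≢ 0# ×
      a' ≡ t * a × b' ≡ t * b × c' ≡ t * c ×
      d' ≡ t * d × e' ≡ t * e × f' ≡ t * f

  ExactlyOf : ∀ {N} → ℕ → (Fin N → Set) → Set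
  ExactlyOf {N} k Q =
    Σ (Fin k → Fin N) λ g → Injective _≡_ _≡_ g ×
      (∀ j → Q j ⇔ (∃ λ t → g t ≡ j))

  record PointConicConfiguration (N k : ℕ) : Set where
    field
      point : Fin N → Point
      conic : Fin N → Conic
      points-distinct : Injective _≡_ _≡_ point
      conics-distinct : ∀ i j → SameConic (conic i) (conic j) → i ≡ j
      conics-nondegenerate : ∀ j → NonDegenerate (conic j)
      point-degree : ∀ i → ExactlyOf k (λ j → point i lies-on conic j)
      conic-degree : ∀ j → ExactlyOf k (λ i → point i lies-on conic j)

-- Give every vertex v of the discrete torus ℤ/m × ℤ/n a distinct odd weight w_v and take the
-- 2mn points (±w_v, ±w_v³) on the cubic y = x³. For every vertex b and each of the two axis
-- directions, take the conic through the three vertices b, b + e, b + 2e: with A, B, C the squared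
-- weights, substituting y = x³ into the conic
--   (AB + BC + CA) x² − (A + B + C) x y + y² − ABC = 0
-- gives (x² − A)(x² − B)(x² − C) = 0, so the conic contains exactly the six points ±√A, ±√B, ±√C.
-- Hence every conic carries 6 points and every point lies on the 3 + 3 conics whose window
-- contains its vertex. The determinant of such a conic is 2ABC(A² + B² + C² − 2(AB + BC + CA)),
-- which is nonzero because A, B, C are odd. Conics are distinct because a conic determines its
-- points, and on a cycle of length at least 4 a window of three consecutive vertices determines
-- its first vertex.

module Submission where

open import Level using (0ℓ)
open import Data.Nat as ℕ using (ℕ; zero; suc; NonZero)
import Data.Nat.Properties as ℕ
import Data.Nat.Divisibility as ℕ
import Data.Nat.Tactic.RingSolver as ℕ-Solver
open import Data.Integer as ℤ using (ℤ; +_; -[1+_]; +[1+_]; _⊖_; _◃_; ∣_∣)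
import Data.Integer.Properties as ℤ
open import Data.Integer.DivMod using (_%ℕ_; _/ℕ_; n%ℕd<d; a≡a%ℕn+[a/ℕn]*n)
import Data.Integer.Divisibility.Signed as ℤ
import Data.Integer.Tactic.RingSolver as ℤ-Solver
import Data.Sign.Base as Sign
open import Data.Fin using (Fin; toℕ; fromℕ<)
open import Data.Fin.Patterns using (0F; 1F; 2F)
import Data.Fin.Properties as Fin
open import Data.Product using (Σ; ∃; _×_; _,_; proj₂; map₂)
open import Data.Product.Properties using (,-injectiveˡ; ,-injectiveʳ)
open import Data.Product.Algebra using (×-cong; Σ-assoc)
open import Data.Sum using (_⊎_; inj₁; inj₂; [_,_])
open import Data.Sum.Function.Propositional using (_⊎-⇔_)
open import Data.Maybe using (map)
open import Data.Empty using (⊥-elim)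
open import Function using (_∘_; _⇔_; mk⇔; _↔_; Inverse; Equivalence)
open import Function.Bundles using (Injection)
open import Function.Definitions using (Injective)
import Function.Properties.Equivalence as ⇔
open import Function.Properties.Inverse using (↔⇒↣; ↔-sym; ↔-refl; ↔-trans)
open import Relation.Nullary using (¬_)
open import Relation.Nullary.Decidable using (dec⇒maybe)
open import Relation.Binary.Definitions using (tri<; tri≈; tri>)
open import Relation.Binary.PropositionalEquality
  using (_≡_; _≢_; refl; sym; trans; cong; cong₂; subst; subst₂; ≢-sym; module ≡-Reasoning)
import Relation.Binary.Reasoning.Setoid as SetoidReasoning
open import Algebra.Bundles using (CommutativeRing)
import Algebra.Properties.Ring as RingProperties
import Algebra.Properties.Monoid.Mult.TCOptimised as MonoidMult
import Algebra.Properties.Semiring.Mult.TCOptimised as SemiringMult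
open import Algebra.Solver.Ring.AlmostCommutativeRing
  using (fromCommutativeRing; _-Raw-AlmostCommutative⟶_)
import Algebra.Solver.Ring as RingSolver
open import Defs

-- The ring solver needs a coefficient ring with decidable equality mapping into R; ℤ, being
-- initial, always serves.
module IntegerCoefficients {c ℓ} (R : CommutativeRing c ℓ) where
  open CommutativeRing R renaming (refl to ≈-refl; sym to ≈-sym; trans to ≈-trans)
  open RingProperties ring using (-‿distribˡ-*; -‿distribʳ-*; -‿involutive; -0#≈0#; -‿+-comm)
  open MonoidMult +-monoid using (1+×; ×-homo-+) renaming (_×_ to _×′_)
  open SemiringMult semiring using (×1-homo-*)
  open SetoidReasoning setoid

  -- The optimised multiplication makes ι 1 = 1# and ι 2 = 1# + 1# hold definitionally.
  ι : ℕ → Carrier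
  ι n = n ×′ 1#

  ι-suc : ∀ n → ι (suc n) ≈ 1# + ι n
  ι-suc n = 1+× n 1#

  ι-homo-+ : ∀ m n → ι (m ℕ.+ n) ≈ ι m + ι n
  ι-homo-+ = ×-homo-+ 1#

  ι-homo-* : ∀ m n → ι (m ℕ.* n) ≈ ι m * ι n
  ι-homo-* = ×1-homo-*

  ιℤ : ℤ → Carrier
  ιℤ (+ n)     = ι n
  ιℤ -[1+ n ] = - ι (suc n)

  ιℤ-⊖ : ∀ m n → ιℤ (m ⊖ n) ≈ ι m - ι n
  ιℤ-⊖ m zero = begin
    ιℤ (m ⊖ 0)  ≡⟨ cong ιℤ (ℤ.⊖-≥ {m} ℕ.z≤n) ⟩
    ι m         ≈⟨ +-identityʳ (ι m) ⟨
    ι m + 0#    ≈⟨ +-congˡ -0#≈0# ⟨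
    ι m - ι 0   ∎
  ιℤ-⊖ zero (suc n) = ≈-sym (+-identityˡ _)
  ιℤ-⊖ (suc m) (suc n) = begin
    ιℤ (suc m ⊖ suc n)           ≡⟨ cong ιℤ (ℤ.[1+m]⊖[1+n]≡m⊖n m n) ⟩
    ιℤ (m ⊖ n)                   ≈⟨ ιℤ-⊖ m n ⟩
    ι m - ι n                    ≈⟨ +-congˡ (+-identityˡ (- ι n)) ⟨
    ι m + (0# - ι n)             ≈⟨ +-congˡ (+-congʳ (-‿inverseʳ 1#)) ⟨
    ι m + ((1# - 1#) - ι n)      ≈⟨ +-congˡ (+-assoc 1# (- 1#) (- ι n)) ⟩
    ι m + (1# + (- 1# - ι n))    ≈⟨ +-assoc (ι m) 1# _ ⟨
    (ι m + 1#) + (- 1# - ι n)    ≈⟨ +-cong (+-comm (ι m) 1#) (-‿+-comm 1# (ι n)) ⟩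
    (1# + ι m) - (1# + ι n)      ≈⟨ +-cong (ι-suc m) (-‿cong (ι-suc n)) ⟨
    ι (suc m) - ι (suc n)        ∎

  ιℤ-homo-- : ∀ i → ιℤ (ℤ.- i) ≈ - ιℤ i
  ιℤ-homo-- (+ zero)  = ≈-sym -0#≈0#
  ιℤ-homo-- +[1+ n ]  = ≈-refl
  ιℤ-homo-- -[1+ n ]  = ≈-sym (-‿involutive _)

  ιℤ-homo-+ : ∀ i j → ιℤ (i ℤ.+ j) ≈ ιℤ i + ιℤ j
  ιℤ-homo-+ (+ m)    (+ n)    = ι-homo-+ m n
  ιℤ-homo-+ (+ m)    -[1+ n ] = ιℤ-⊖ m (suc n)
  ιℤ-homo-+ -[1+ m ] (+ n)    = ≈-trans (ιℤ-⊖ n (suc m)) (+-comm _ _)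
  ιℤ-homo-+ -[1+ m ] -[1+ n ] = begin
    - ι (suc (suc (m ℕ.+ n)))      ≡⟨ cong (λ k → - ι (suc k)) (ℕ.+-suc m n) ⟨
    - ι (suc m ℕ.+ suc n)          ≈⟨ -‿cong (ι-homo-+ (suc m) (suc n)) ⟩
    - (ι (suc m) + ι (suc n))      ≈⟨ -‿+-comm _ _ ⟨
    - ι (suc m) + - ι (suc n)      ∎

  ιℤ-homo-* : ∀ i j → ιℤ (i ℤ.* j) ≈ ιℤ i * ιℤ j
  ιℤ-homo-* (+ m) (+ n) = ≈-trans (reflexive (cong ιℤ (ℤ.+◃n≡+n (m ℕ.* n)))) (ι-homo-* m n)
  ιℤ-homo-* (+ m) -[1+ n ] = begin
    ιℤ (Sign.- ◃ (m ℕ.* suc n))   ≡⟨ cong ιℤ (ℤ.-◃n≡-n (m ℕ.* suc n)) ⟩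
    ιℤ (ℤ.- + (m ℕ.* suc n))      ≈⟨ ιℤ-homo-- (+ (m ℕ.* suc n)) ⟩
    - ι (m ℕ.* suc n)             ≈⟨ -‿cong (ι-homo-* m (suc n)) ⟩
    - (ι m * ι (suc n))           ≈⟨ -‿distribʳ-* _ _ ⟩
    ι m * - ι (suc n)             ∎
  ιℤ-homo-* -[1+ m ] (+ n) = begin
    ιℤ (Sign.- ◃ (suc m ℕ.* n))   ≡⟨ cong ιℤ (ℤ.-◃n≡-n (suc m ℕ.* n)) ⟩
    ιℤ (ℤ.- + (suc m ℕ.* n))      ≈⟨ ιℤ-homo-- (+ (suc m ℕ.* n)) ⟩
    - ι (suc m ℕ.* n)             ≈⟨ -‿cong (ι-homo-* (suc m) n) ⟩
    - (ι (suc m) * ι n)           ≈⟨ -‿distribˡ-* _ _ ⟩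
    - ι (suc m) * ι n             ∎
  ιℤ-homo-* -[1+ m ] -[1+ n ] = begin
    ι (suc m ℕ.* suc n)           ≈⟨ ι-homo-* (suc m) (suc n) ⟩
    a * b                         ≈⟨ -‿involutive _ ⟨
    - (- (a * b))                 ≈⟨ -‿cong (-‿distribʳ-* a b) ⟩
    - (a * - b)                   ≈⟨ -‿distribˡ-* a (- b) ⟩
    - a * - b                     ∎
    where a = ι (suc m) ; b = ι (suc n)

  homomorphism : ℤ.+-*-rawRing -Raw-AlmostCommutative⟶ fromCommutativeRing R
  homomorphism = record
    { ⟦_⟧    = ιℤ
    ; +-homo = ιℤ-homo-+
    ; *-homo = ιℤ-homo-*
    ; -‿homo = ιℤ-homo--
    ; 0-homo = ≈-refl
    ; 1-homo = ≈-refl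
    }

  open RingSolver ℤ.+-*-rawRing (fromCommutativeRing R) homomorphism
    (λ i j → map (λ i≡j → reflexive (cong ιℤ i≡j)) (dec⇒maybe (i ℤ.≟ j))) public

module RealFieldProperties (R : RealField) where
  open RealField R

  commutativeRing : CommutativeRing 0ℓ 0ℓ
  commutativeRing = record { isCommutativeRing = isCommutativeRing }

  open CommutativeRing commutativeRing
    using (+-comm; +-identityˡ; *-identityˡ; zeroˡ; zeroʳ; -‿inverseʳ; ring)
  open RingProperties ring using (x∙y⁻¹≈ε⇒x≈y; x≈y⇒x∙y⁻¹≈ε; +-cancelˡ)
  open IntegerCoefficients commutativeRing public
  open ≡-Reasoning

  -x*-x≡x*x : ∀ x → - x * - x ≡ x * x
  -x*-x≡x*x = solve 1 (λ x → :- x :* :- x := x :* x) refl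

  <-irrefl : ∀ {x} → ¬ (x < x)
  <-irrefl {x} with <-tri x x
  ... | tri< _ x≢x _ = ⊥-elim (x≢x refl)
  ... | tri≈ x≮x _ _ = x≮x
  ... | tri> x≮x _ _ = x≮x

  <⇒≢ : ∀ {x y} → x < y → x ≢ y
  <⇒≢ x<y refl = <-irrefl x<y

  0<1 : 0# < 1#
  0<1 with <-tri 0# 1#
  ... | tri< 0<1 _ _ = 0<1
  ... | tri≈ _ 0≡1 _ = ⊥-elim (0≢1 0≡1)
  ... | tri> _ _ 1<0 = ⊥-elim (<-irrefl (<-trans 1<0 0<[-1]*[-1]))
    where
    0<-1 : 0# < - 1#
    0<-1 = subst₂ _<_ (-‿inverseʳ 1#) (+-identityˡ (- 1#)) (+-mono-< (- 1#) 1<0)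
    0<[-1]*[-1] : 0# < 1#
    0<[-1]*[-1] = subst (0# <_) (trans (-x*-x≡x*x 1#) (*-identityˡ 1#)) (*-pos 0<-1 0<-1)

  +-positive : ∀ {x y} → 0# < x → 0# < y → 0# < x + y
  +-positive {x} {y} 0<x 0<y =
    <-trans 0<x (subst₂ _<_ (+-identityˡ x) (+-comm y x) (+-mono-< x 0<y))

  ι-positive : ∀ n → 0# < ι (suc n)
  ι-positive zero    = 0<1
  ι-positive (suc n) = subst (0# <_) (sym (ι-suc (suc n))) (+-positive 0<1 (ι-positive n))

  ι-suc≢0 : ∀ n → ι (suc n) ≢ 0#
  ι-suc≢0 n = ≢-sym (<⇒≢ (ι-positive n))

  ι-injective : ∀ {m n} → ι m ≡ ι n → m ≡ n
  ι-injective {zero}  {zero}  _ = refl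
  ι-injective {zero}  {suc n} e = ⊥-elim (<⇒≢ (ι-positive n) e)
  ι-injective {suc m} {zero}  e = ⊥-elim (<⇒≢ (ι-positive m) (sym e))
  ι-injective {suc m} {suc n} e =
    cong suc (ι-injective (+-cancelˡ 1# _ _ (trans (sym (ι-suc m)) (trans e (ι-suc n)))))

  ι-sum-of-products : ∀ a b c d e f →
    ι (a ℕ.* b ℕ.+ c ℕ.* d ℕ.+ e ℕ.* f) ≡ ι a * ι b + ι c * ι d + ι e * ι f
  ι-sum-of-products a b c d e f =
    trans (ι-homo-+ (a ℕ.* b ℕ.+ c ℕ.* d) (e ℕ.* f))
      (cong₂ _+_ (trans (ι-homo-+ (a ℕ.* b) (c ℕ.* d)) (cong₂ _+_ (ι-homo-* a b) (ι-homo-* c d)))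
                 (ι-homo-* e f))

  ι-sum-of-squares≢twice-sum-of-products : ∀ a b c →
    a ℕ.* a ℕ.+ b ℕ.* b ℕ.+ c ℕ.* c ≢ 2 ℕ.* (a ℕ.* b ℕ.+ b ℕ.* c ℕ.+ c ℕ.* a) →
    ι a * ι a + ι b * ι b + ι c * ι c ≢ (1# + 1#) * (ι a * ι b + ι b * ι c + ι c * ι a)
  ι-sum-of-squares≢twice-sum-of-products a b c unbalanced eq = unbalanced (ι-injective (begin
    ι (a ℕ.* a ℕ.+ b ℕ.* b ℕ.+ c ℕ.* c)          ≡⟨ ι-sum-of-products a a b b c c ⟩
    ι a * ι a + ι b * ι b + ι c * ι c            ≡⟨ eq ⟩
    ι 2 * (ι a * ι b + ι b * ι c + ι c * ι a)    ≡⟨ cong (ι 2 *_) (ι-sum-of-products a b b c c a) ⟨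
    ι 2 * ι (a ℕ.* b ℕ.+ b ℕ.* c ℕ.+ c ℕ.* a)    ≡⟨ ι-homo-* 2 (a ℕ.* b ℕ.+ b ℕ.* c ℕ.+ c ℕ.* a) ⟨
    ι (2 ℕ.* (a ℕ.* b ℕ.+ b ℕ.* c ℕ.+ c ℕ.* a))  ∎))

  x≢0⇒x*y≡0⇒y≡0 : ∀ {x y} → x ≢ 0# → x * y ≡ 0# → y ≡ 0#
  x≢0⇒x*y≡0⇒y≡0 {x} {y} x≢0 xy≡0 = begin
    y               ≡⟨ *-identityˡ y ⟨
    1# * y          ≡⟨ cong (_* y) (⁻¹-inverse x x≢0) ⟨
    x * x ⁻¹ * y    ≡⟨ solve 3 (λ x x⁻¹ y → x :* x⁻¹ :* y := x⁻¹ :* (x :* y)) refl x (x ⁻¹) y ⟩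
    x ⁻¹ * (x * y)  ≡⟨ cong (x ⁻¹ *_) xy≡0 ⟩
    x ⁻¹ * 0#       ≡⟨ zeroʳ (x ⁻¹) ⟩
    0#              ∎

  x*y≡0⇔x≡0∨y≡0 : ∀ {x y} → x * y ≡ 0# ⇔ (x ≡ 0# ⊎ y ≡ 0#)
  x*y≡0⇔x≡0∨y≡0 {x} {y} = mk⇔ to from
    where
    to : x * y ≡ 0# → x ≡ 0# ⊎ y ≡ 0#
    to xy≡0 with <-tri x 0#
    ... | tri< _ x≢0 _ = inj₂ (x≢0⇒x*y≡0⇒y≡0 x≢0 xy≡0)
    ... | tri≈ _ x≡0 _ = inj₁ x≡0
    ... | tri> _ x≢0 _ = inj₂ (x≢0⇒x*y≡0⇒y≡0 x≢0 xy≡0)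
    from : x ≡ 0# ⊎ y ≡ 0# → x * y ≡ 0#
    from (inj₁ refl) = zeroˡ y
    from (inj₂ refl) = zeroʳ x

  *-nonzero : ∀ {x y} → x ≢ 0# → y ≢ 0# → x * y ≢ 0#
  *-nonzero x≢0 y≢0 xy≡0 = [ x≢0 , y≢0 ] (Equivalence.to x*y≡0⇔x≡0∨y≡0 xy≡0)

  x-y≡0⇔x≡y : ∀ {x y} → x + - y ≡ 0# ⇔ x ≡ y
  x-y≡0⇔x≡y {x} {y} = mk⇔ (x∙y⁻¹≈ε⇒x≈y x y) x≈y⇒x∙y⁻¹≈ε

  positive-square-injective : ∀ {x y} → 0# < x → 0# < y → x * x ≡ y * y → x ≡ y
  positive-square-injective {x} {y} 0<x 0<y xx≡yy =
    [ Equivalence.to x-y≡0⇔x≡y , (λ x+y≡0 → ⊥-elim (<⇒≢ (+-positive 0<x 0<y) (sym x+y≡0))) ]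
      (Equivalence.to x*y≡0⇔x≡0∨y≡0 (trans difference-of-squares (Equivalence.from x-y≡0⇔x≡y xx≡yy)))
    where
    difference-of-squares : (x + - y) * (x + y) ≡ x * x + - (y * y)
    difference-of-squares =
      solve 2 (λ x y → (x :+ :- y) :* (x :+ y) := x :* x :+ :- (y :* y)) refl x y

module CubicConics (R : RealField) where
  open RealField R
  open RealFieldProperties R
  open CommutativeRing commutativeRing using (zeroʳ; -‿inverseˡ; ring)
  open RingProperties ring using (-‿injective)

  cubicPoint : Carrier → Point R
  cubicPoint x = x , x * x * x

  conicThrough : Carrier → Carrier → Carrier → Conic R
  conicThrough A B C =
    mkConic (A * B + B * C + C * A) (- (A + B + C)) 1# 0# 0# (- (A * B * C))

  cubicPoint-lies-on-conicThrough : ∀ x A B C →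
    _lies-on_ R (cubicPoint x) (conicThrough A B C) ⇔ (x * x ≡ A ⊎ x * x ≡ B ⊎ x * x ≡ C)
  cubicPoint-lies-on-conicThrough x A B C = begin
    _lies-on_ R (cubicPoint x) (conicThrough A B C)
      ≈⟨ mk⇔ (trans (sym restriction)) (trans restriction) ⟩
    (x * x + - A) * ((x * x + - B) * (x * x + - C)) ≡ 0#
      ≈⟨ ⇔.trans x*y≡0⇔x≡0∨y≡0 (⇔.refl ⊎-⇔ x*y≡0⇔x≡0∨y≡0) ⟩
    (x * x + - A ≡ 0# ⊎ x * x + - B ≡ 0# ⊎ x * x + - C ≡ 0#)
      ≈⟨ x-y≡0⇔x≡y ⊎-⇔ x-y≡0⇔x≡y ⊎-⇔ x-y≡0⇔x≡y ⟩
    (x * x ≡ A ⊎ x * x ≡ B ⊎ x * x ≡ C) ∎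
    where
    open SetoidReasoning (⇔.⇔-setoid 0ℓ)
    restriction : (A * B + B * C + C * A) * x * x + - (A + B + C) * x * (x * x * x)
                  + 1# * (x * x * x) * (x * x * x) + 0# * x + 0# * (x * x * x) + - (A * B * C)
                  ≡ (x * x + - A) * ((x * x + - B) * (x * x + - C))
    restriction = solve 4 (λ x A B C →
      (A :* B :+ B :* C :+ C :* A) :* x :* x :+ :- (A :+ B :+ C) :* x :* (x :* x :* x)
      :+ con (+ 1) :* (x :* x :* x) :* (x :* x :* x) :+ con (+ 0) :* x
      :+ con (+ 0) :* (x :* x :* x) :+ :- (A :* B :* C)
      := (x :* x :+ :- A) :* ((x :* x :+ :- B) :* (x :* x :+ :- C))) refl x A B C

  conicThrough-nondegenerate : ∀ {A B C} → A ≢ 0# → B ≢ 0# → C ≢ 0# →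
    A * A + B * B + C * C ≢ (1# + 1#) * (A * B + B * C + C * A) →
    NonDegenerate R (conicThrough A B C)
  conicThrough-nondegenerate {A} {B} {C} A≢0 B≢0 C≢0 unbalanced det≡0 =
    *-nonzero (*-nonzero (ι-suc≢0 1) (*-nonzero (*-nonzero A≢0 B≢0) C≢0))
              (unbalanced ∘ Equivalence.to x-y≡0⇔x≡y)
              (trans (sym determinant) det≡0)
    where
    determinant : det3 R (2× R (A * B + B * C + C * A)) (- (A + B + C)) 0#
                         (- (A + B + C)) (2× R 1#) 0#
                         0# 0# (2× R (- (A * B * C)))
                  ≡ (1# + 1#) * (A * B * C)
                    * (A * A + B * B + C * C + - ((1# + 1#) * (A * B + B * C + C * A)))
    determinant = solve 3 (λ A B C →
      let a = A :* B :+ B :* C :+ C :* A ; b = :- (A :+ B :+ C) ; f = :- (A :* B :* C)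
          O = con (+ 0) ; I = con (+ 1) in
      (a :+ a) :* ((I :+ I) :* (f :+ f) :+ :- (O :* O))
      :+ :- (b :* (b :* (f :+ f) :+ :- (O :* O)))
      :+ O :* (b :* O :+ :- ((I :+ I) :* O))
      := (I :+ I) :* (A :* B :* C) :* (A :* A :+ B :* B :+ C :* C :+ :- ((I :+ I) :* a)))
      refl A B C

  sameConic-lies-on : ∀ {c c'} p → SameConic R c c' → _lies-on_ R p c → _lies-on_ R p c'
  sameConic-lies-on {mkConic a b c d e f} (x , y)
                    (t , _ , refl , refl , refl , refl , refl , refl) p∈c =
    trans (solve 9 (λ t a b c d e f x y →
             t :* a :* x :* x :+ t :* b :* x :* y :+ t :* c :* y :* y
               :+ t :* d :* x :+ t :* e :* y :+ t :* f
             := t :* (a :* x :* x :+ b :* x :* y :+ c :* y :* y :+ d :* x :+ e :* y :+ f))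
             refl t a b c d e f x y)
          (trans (cong (t *_) p∈c) (zeroʳ t))

  signed : Fin 2 → Carrier → Carrier
  signed 0F x = x
  signed 1F x = - x

  signed-square : ∀ s x → signed s x * signed s x ≡ x * x
  signed-square 0F x = refl
  signed-square 1F x = -x*-x≡x*x x

  signed-injective : ∀ {s s' x y} → 0# < x → 0# < y → signed s x ≡ signed s' y → s ≡ s' × x ≡ y
  signed-injective {0F} {0F} _   _   x≡y   = refl , x≡y
  signed-injective {1F} {1F} _   _   -x≡-y = refl , -‿injective -x≡-y
  signed-injective {0F} {1F} 0<x 0<y x≡-y  =
    ⊥-elim (<⇒≢ (+-positive 0<x 0<y) (sym (trans (cong (_+ _) x≡-y) (-‿inverseˡ _))))
  signed-injective {1F} {0F} 0<x 0<y -x≡y  =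
    ⊥-elim (<⇒≢ (+-positive 0<y 0<x) (sym (trans (cong (_+ _) (sym -x≡y)) (-‿inverseˡ _))))

-- On A = Fin N this is ExactlyOf, definitionally.
Exactly : ∀ {A : Set} → ℕ → (A → Set) → Set
Exactly {A} k P = Σ (Fin k → A) λ g → Injective _≡_ _≡_ g × (∀ a → P a ⇔ (∃ λ t → g t ≡ a))

to-injective : ∀ {A B : Set} (e : A ↔ B) → Injective _≡_ _≡_ (Inverse.to e)
to-injective e = Injection.injective (↔⇒↣ e)

from-injective : ∀ {A B : Set} (e : A ↔ B) → Injective _≡_ _≡_ (Inverse.from e)
from-injective e = to-injective (↔-sym e)

module _ {A : Set} {k : ℕ} where

  Exactly-cong : ∀ {P Q : A → Set} → (∀ a → P a ⇔ Q a) → Exactly k P → Exactly k Q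
  Exactly-cong P⇔Q (g , g-injective , P⇔image) =
    g , g-injective , λ a → ⇔.trans (⇔.sym (P⇔Q a)) (P⇔image a)

  Exactly-image : ∀ {B : Set} (B↔Fin : B ↔ Fin k) (f : B → A) → Injective _≡_ _≡_ f →
                  Exactly k (λ a → ∃ λ b → f b ≡ a)
  Exactly-image B↔Fin f f-injective =
    f ∘ from , from-injective B↔Fin ∘ f-injective , λ a →
      mk⇔ (λ (b , fb≡a) → to b , trans (cong f (strictlyInverseʳ b)) fb≡a)
          (λ (t , e) → from t , e)
    where open Inverse B↔Fin

  Exactly-pullback : ∀ {B : Set} {P : A → Set} (e : B ↔ A) → Exactly k P →
                     Exactly k (P ∘ Inverse.to e)
  Exactly-pullback e (g , g-injective , P⇔image) =
    from ∘ g , g-injective ∘ from-injective e , λ b → ⇔.trans (P⇔image (to b))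
      (mk⇔ (λ (t , gt≡b) → t , trans (cong from gt≡b) (strictlyInverseʳ b))
           (λ (t , e) → t , trans (sym (strictlyInverseˡ (g t))) (cong to e)))
    where open Inverse e

∃-Fin3⇔ : ∀ {P : Fin 3 → Set} → ∃ P ⇔ (P 0F ⊎ P 1F ⊎ P 2F)
∃-Fin3⇔ {P} = mk⇔ to [ (0F ,_) , [ (1F ,_) , (2F ,_) ] ]
  where
  to : ∃ P → P 0F ⊎ P 1F ⊎ P 2F
  to (0F , p) = inj₁ p
  to (1F , p) = inj₂ (inj₁ p)
  to (2F , p) = inj₂ (inj₂ p)

module _ where
  open import Data.Nat.Base using (_+_; _*_)

  odd-square : ∀ k → suc (2 * k) * suc (2 * k) ≡ suc (2 * (2 * k + 2 * k * k))
  odd-square = ℕ-Solver.solve-∀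

  odd-sum-of-squares≢even : ∀ i j k →
    let a = suc (2 * i) ; b = suc (2 * j) ; c = suc (2 * k) in
    a * a + b * b + c * c ≢ 2 * (a * b + b * c + c * a)
  odd-sum-of-squares≢even i j k eq =
    ℕ.even≢odd (a * b + b * c + c * a) (1 + 2 * (i + j + k) + 2 * (i * i + j * j + k * k))
               (trans (sym eq) (sum-of-squares-odd i j k))
    where
    a = suc (2 * i) ; b = suc (2 * j) ; c = suc (2 * k)
    sum-of-squares-odd : ∀ i j k →
      suc (2 * i) * suc (2 * i) + suc (2 * j) * suc (2 * j) + suc (2 * k) * suc (2 * k)
      ≡ suc (2 * (1 + 2 * (i + j + k) + 2 * (i * i + j * j + k * k)))
    sum-of-squares-odd = ℕ-Solver.solve-∀

record TripleSystem (V E : Set) : Set₁ where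
  field
    triple : E → Fin 3 → V
    triple-injective : ∀ e → Injective _≡_ _≡_ (triple e)

  _∈_ : V → E → Set
  v ∈ e = ∃ λ d → triple e d ≡ v

  field
    triple-determines : ∀ {e e'} → (∀ d → triple e d ∈ e') → e ≡ e'
    degree : ∀ v → Exactly 6 (v ∈_)

module Realisation (R : RealField) {V E : Set} (T : TripleSystem V E)
                   (code : V → ℕ) (code-injective : Injective _≡_ _≡_ code) where
  open RealField R
  open RealFieldProperties R
  open CubicConics R
  open TripleSystem T

  weight : V → Carrier
  weight v = ι (suc (2 ℕ.* code v))

  weight-positive : ∀ v → 0# < weight v
  weight-positive v = ι-positive (2 ℕ.* code v)

  weight-injective : ∀ {u v} → weight u ≡ weight v → u ≡ v
  weight-injective eq = code-injective (ℕ.*-cancelˡ-≡ _ _ 2 (ℕ.suc-injective (ι-injective eq)))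

  square : V → Carrier
  square v = weight v * weight v

  square-injective : ∀ {u v} → square u ≡ square v → u ≡ v
  square-injective {u} {v} eq =
    weight-injective (positive-square-injective (weight-positive u) (weight-positive v) eq)

  square≢0 : ∀ v → square v ≢ 0#
  square≢0 v = *-nonzero (ι-suc≢0 (2 ℕ.* code v)) (ι-suc≢0 (2 ℕ.* code v))

  square-odd : ∀ v → square v ≡ ι (suc (2 ℕ.* (2 ℕ.* code v ℕ.+ 2 ℕ.* code v ℕ.* code v)))
  square-odd v = trans (sym (ι-homo-* k k)) (cong ι (odd-square (code v)))
    where k = suc (2 ℕ.* code v)

  squares-unbalanced : ∀ u v w →
    square u * square u + square v * square v + square w * square w
      ≢ (1# + 1#) * (square u * square v + square v * square w + square w * square u)
  squares-unbalanced u v w rewrite square-odd u | square-odd v | square-odd w =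
    ι-sum-of-squares≢twice-sum-of-products (odd (h u)) (odd (h v)) (odd (h w))
      (odd-sum-of-squares≢even (h u) (h v) (h w))
    where
    odd : ℕ → ℕ
    odd n = suc (2 ℕ.* n)
    h : V → ℕ
    h v = 2 ℕ.* code v ℕ.+ 2 ℕ.* code v ℕ.* code v

  point : Fin 2 × V → Point R
  point (s , v) = cubicPoint (signed s (weight v))

  conic : E → Conic R
  conic e = conicThrough (square (triple e 0F)) (square (triple e 1F)) (square (triple e 2F))

  lies-on⇔∈ : ∀ s v e → _lies-on_ R (point (s , v)) (conic e) ⇔ v ∈ e
  lies-on⇔∈ s v e = begin
    _lies-on_ R (point (s , v)) (conic e)
      ≈⟨ cubicPoint-lies-on-conicThrough x _ _ _ ⟩
    (x * x ≡ square (triple e 0F) ⊎ x * x ≡ square (triple e 1F) ⊎ x * x ≡ square (triple e 2F))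
      ≈⟨ x*x≡square⇔ _ ⊎-⇔ x*x≡square⇔ _ ⊎-⇔ x*x≡square⇔ _ ⟩
    (triple e 0F ≡ v ⊎ triple e 1F ≡ v ⊎ triple e 2F ≡ v)
      ≈⟨ ⇔.sym ∃-Fin3⇔ ⟩
    v ∈ e ∎
    where
    open SetoidReasoning (⇔.⇔-setoid 0ℓ)
    x = signed s (weight v)
    x*x≡square⇔ : ∀ u → x * x ≡ square u ⇔ u ≡ v
    x*x≡square⇔ u = mk⇔ (λ eq → square-injective (trans (sym eq) (signed-square s (weight v))))
                        (λ { refl → signed-square s (weight v) })

  point-injective : Injective _≡_ _≡_ point
  point-injective {s , u} {s' , v} eq =
    let s≡s' , wu≡wv = signed-injective {s} {s'} (weight-positive u) (weight-positive v) (,-injectiveˡ eq)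
    in cong₂ _,_ s≡s' (weight-injective wu≡wv)

  conic-injective : ∀ {e e'} → SameConic R (conic e) (conic e') → e ≡ e'
  conic-injective {e} {e'} same = triple-determines λ d →
    Equivalence.to (lies-on⇔∈ 0F _ e')
      (sameConic-lies-on (point (0F , triple e d)) same (Equivalence.from (lies-on⇔∈ 0F _ e) (d , refl)))

  conic-nondegenerate : ∀ e → NonDegenerate R (conic e)
  conic-nondegenerate e = conicThrough-nondegenerate (square≢0 _) (square≢0 _) (square≢0 _)
                                                     (squares-unbalanced _ _ _)

  point-degree : ∀ p → Exactly 6 (λ e → _lies-on_ R (point p) (conic e))
  point-degree (s , v) = Exactly-cong (λ e → ⇔.sym (lies-on⇔∈ s v e)) (degree v)

  pointsOn : E → Fin 2 × Fin 3 → Fin 2 × V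
  pointsOn e (s , d) = s , triple e d

  pointsOn-injective : ∀ e → Injective _≡_ _≡_ (pointsOn e)
  pointsOn-injective e eq = cong₂ _,_ (,-injectiveˡ eq) (triple-injective e (,-injectiveʳ eq))

  conic-degree : ∀ e → Exactly 6 (λ p → _lies-on_ R (point p) (conic e))
  conic-degree e = Exactly-cong pointsOn⇔lies-on
    (Exactly-image (↔-sym Fin.*↔×) (pointsOn e) (pointsOn-injective e))
    where
    pointsOn⇔lies-on : ∀ p → (∃ λ c → pointsOn e c ≡ p) ⇔ _lies-on_ R (point p) (conic e)
    pointsOn⇔lies-on (s , v) = ⇔.trans
      (mk⇔ (λ ((_ , d) , eq) → d , ,-injectiveʳ eq) (λ (d , eq) → (s , d) , cong (s ,_) eq))
      (⇔.sym (lies-on⇔∈ s v e))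

  configuration : ∀ {N} → Fin N ↔ (Fin 2 × V) → Fin N ↔ E → PointConicConfiguration R N 6
  configuration pointIndex conicIndex = record
    { point                = point ∘ P.to
    ; conic                = conic ∘ C.to
    ; points-distinct      = to-injective pointIndex ∘ point-injective
    ; conics-distinct      = λ _ _ → to-injective conicIndex ∘ conic-injective
    ; conics-nondegenerate = conic-nondegenerate ∘ C.to
    ; point-degree         = λ i → Exactly-pullback conicIndex (point-degree (P.to i))
    ; conic-degree         = λ j → Exactly-pullback pointIndex (conic-degree (C.to j))
    }
    where
    module P = Inverse pointIndex
    module C = Inverse conicIndex

module _ {K : ℕ} .⦃ _ : NonZero K ⦄ where

  toℤ : Fin K → ℤ
  toℤ x = + toℕ x

  infixl 6 _⊕_
  _⊕_ : Fin K → ℤ → Fin K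
  x ⊕ d = fromℕ< (n%ℕd<d (toℤ x ℤ.+ d) K)

  ⊕-congruent : ∀ x d → + K ℤ.∣ (toℤ x ℤ.+ d) ℤ.- toℤ (x ⊕ d)
  ⊕-congruent x d = ℤ.divides q (begin
    (toℤ x ℤ.+ d) ℤ.- toℤ (x ⊕ d)   ≡⟨ cong (λ r → (toℤ x ℤ.+ d) ℤ.- + r) (Fin.toℕ-fromℕ< (n%ℕd<d (toℤ x ℤ.+ d) K)) ⟩
    (toℤ x ℤ.+ d) ℤ.- + r           ≡⟨ cong (ℤ._- + r) (a≡a%ℕn+[a/ℕn]*n (toℤ x ℤ.+ d) K) ⟩
    (+ r ℤ.+ q ℤ.* + K) ℤ.- + r     ≡⟨ cancel (+ r) (q ℤ.* + K) ⟩
    q ℤ.* + K                       ∎)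
    where
    open ≡-Reasoning
    r = (toℤ x ℤ.+ d) %ℕ K
    q = (toℤ x ℤ.+ d) /ℕ K
    cancel : ∀ a b → (a ℤ.+ b) ℤ.- a ≡ b
    cancel = ℤ-Solver.solve-∀

  ∣u-v∣<K : ∀ {u v} → u ℕ.< K → v ℕ.< K → ∣ + u ℤ.- + v ∣ ℕ.< K
  ∣u-v∣<K {u} {v} u<K v<K = subst (ℕ._< K) (cong ∣_∣ (sym (ℤ.m-n≡m⊖n u v)))
    (ℕ.≤-<-trans (ℤ.∣m⊝n∣≤m⊔n u v) (ℕ.⊔-pres-<m u<K v<K))

  K∣z∧∣z∣<K⇒z≡0 : ∀ {z} → + K ℤ.∣ z → ∣ z ∣ ℕ.< K → z ≡ + 0
  K∣z∧∣z∣<K⇒z≡0 {z} K∣z ∣z∣<K with ∣ z ∣ in ∣z∣≡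
  ... | zero  = ℤ.∣i∣≡0⇒i≡0 ∣z∣≡
  ... | suc _ = ⊥-elim (ℕ.<⇒≱ ∣z∣<K (ℕ.∣⇒≤ (subst (K ℕ.∣_) ∣z∣≡ (ℤ.∣⇒∣ᵤ K∣z))))

  K∣u-v⇒u≡v : ∀ {u v} → u ℕ.< K → v ℕ.< K → + K ℤ.∣ + u ℤ.- + v → u ≡ v
  K∣u-v⇒u≡v {u} {v} u<K v<K K∣u-v =
    ℤ.+-injective (ℤ.i-j≡0⇒i≡j (+ u) (+ v) (K∣z∧∣z∣<K⇒z≡0 K∣u-v (∣u-v∣<K u<K v<K)))

  K∣x-y⇒x≡y : ∀ {x y} → + K ℤ.∣ toℤ x ℤ.- toℤ y → x ≡ y
  K∣x-y⇒x≡y {x} {y} K∣x-y = Fin.toℕ-injective (K∣u-v⇒u≡v (Fin.toℕ<n x) (Fin.toℕ<n y) K∣x-y)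

  ⊕≡⇔∣ : ∀ x d y → x ⊕ d ≡ y ⇔ + K ℤ.∣ (toℤ x ℤ.+ d) ℤ.- toℤ y
  ⊕≡⇔∣ x d y = mk⇔ (λ { refl → ⊕-congruent x d }) λ K∣x+d-y →
    K∣x-y⇒x≡y (subst (+ K ℤ.∣_) (difference (toℤ x ℤ.+ d) (toℤ y) (toℤ (x ⊕ d)))
                              (ℤ.∣m∣n⇒∣m-n K∣x+d-y (⊕-congruent x d)))
    where
    difference : ∀ a b c → (a ℤ.- b) ℤ.- (a ℤ.- c) ≡ c ℤ.- b
    difference = ℤ-Solver.solve-∀

  ⊕-⊕ : ∀ x a b → x ⊕ a ⊕ b ≡ x ⊕ (a ℤ.+ b)
  ⊕-⊕ x a b = Equivalence.from (⊕≡⇔∣ (x ⊕ a) b (x ⊕ (a ℤ.+ b)))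
    (subst (+ K ℤ.∣_) (difference (toℤ x) a b (toℤ (x ⊕ a)) (toℤ (x ⊕ (a ℤ.+ b))))
                      (ℤ.∣m∣n⇒∣m-n (⊕-congruent x (a ℤ.+ b)) (⊕-congruent x a)))
    where
    difference : ∀ x a b y z →
      ((x ℤ.+ (a ℤ.+ b)) ℤ.- z) ℤ.- ((x ℤ.+ a) ℤ.- y) ≡ (y ℤ.+ b) ℤ.- z
    difference = ℤ-Solver.solve-∀

  ⊕-inverse : ∀ x d y → x ⊕ d ≡ y ⇔ y ⊕ (ℤ.- d) ≡ x
  ⊕-inverse x d y = mk⇔
    (λ x+d≡y → Equivalence.from (⊕≡⇔∣ y (ℤ.- d) x) (subst (+ K ℤ.∣_) (negation (toℤ x) d (toℤ y))
       (ℤ.∣m⇒∣-m (Equivalence.to (⊕≡⇔∣ x d y) x+d≡y))))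
    (λ y-d≡x → Equivalence.from (⊕≡⇔∣ x d y) (subst (+ K ℤ.∣_) (negation′ (toℤ x) d (toℤ y))
       (ℤ.∣m⇒∣-m (Equivalence.to (⊕≡⇔∣ y (ℤ.- d) x) y-d≡x))))
    where
    negation : ∀ x d y → ℤ.- ((x ℤ.+ d) ℤ.- y) ≡ (y ℤ.+ ℤ.- d) ℤ.- x
    negation = ℤ-Solver.solve-∀
    negation′ : ∀ x d y → ℤ.- ((y ℤ.+ ℤ.- d) ℤ.- x) ≡ (x ℤ.+ d) ℤ.- y
    negation′ = ℤ-Solver.solve-∀

  ⊕-injectiveˡ : ∀ {x y} d → x ⊕ d ≡ y ⊕ d → x ≡ y
  ⊕-injectiveˡ {x} {y} d eq = trans (sym (Equivalence.to (⊕-inverse x d (y ⊕ d)) eq))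
                                    (Equivalence.to (⊕-inverse y d (y ⊕ d)) refl)

  ⊕-injectiveʳ : ∀ x {a b} → a ℕ.< K → b ℕ.< K → x ⊕ + a ≡ x ⊕ + b → a ≡ b
  ⊕-injectiveʳ x {a} {b} a<K b<K eq = K∣u-v⇒u≡v a<K b<K
    (subst (+ K ℤ.∣_) (difference (toℤ x) (+ a) (+ b) (toℤ (x ⊕ + b)))
      (ℤ.∣m∣n⇒∣m-n (Equivalence.to (⊕≡⇔∣ x (+ a) (x ⊕ + b)) eq) (⊕-congruent x (+ b))))
    where
    difference : ∀ x a b z → ((x ℤ.+ a) ℤ.- z) ℤ.- ((x ℤ.+ b) ℤ.- z) ≡ a ℤ.- b
    difference = ℤ-Solver.solve-∀

  ⊕-injectiveʳ⁻ : ∀ x {a b} → a ℕ.< K → b ℕ.< K → x ⊕ (ℤ.- + a) ≡ x ⊕ (ℤ.- + b) → a ≡ b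
  ⊕-injectiveʳ⁻ x {a} {b} a<K b<K eq =
    ⊕-injectiveʳ (x ⊕ (ℤ.- + b)) a<K b<K (trans (back a eq) (sym (back b refl)))
    where
    back : ∀ c {z} → x ⊕ (ℤ.- + c) ≡ z → z ⊕ + c ≡ x
    back c {z} eq = subst (λ d → z ⊕ d ≡ x) (ℤ.neg-involutive (+ c))
                          (Equivalence.to (⊕-inverse x (ℤ.- + c) z) eq)

  -- If y + e = x with e ∈ {1, 2}, then the window of y would have to contain y + 3.
  window-determines : ∀ {x y} → 3 ℕ.< K →
    (∀ (d : Fin 3) → ∃ λ (e : Fin 3) → y ⊕ + toℕ e ≡ x ⊕ + toℕ d) → y ≡ x
  window-determines {x} {y} 3<K window⊆ = from-first (window⊆ 0F)
    where
    shift : ∀ {a} b → y ⊕ + a ≡ x ⊕ + 0 → x ⊕ + b ≡ y ⊕ + (a ℕ.+ b)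
    shift {a} b y+a≡x = begin
      x ⊕ + b          ≡⟨ ⊕-⊕ x (+ 0) (+ b) ⟨
      x ⊕ + 0 ⊕ + b    ≡⟨ cong (_⊕ + b) y+a≡x ⟨
      y ⊕ + a ⊕ + b    ≡⟨ ⊕-⊕ y (+ a) (+ b) ⟩
      y ⊕ + (a ℕ.+ b)  ∎
      where open ≡-Reasoning
    beyond-window : ∀ (e : Fin 3) → y ⊕ + toℕ e ≢ y ⊕ + 3
    beyond-window e eq =
      ℕ.<-irrefl (⊕-injectiveʳ y (ℕ.<-trans (Fin.toℕ<n e) 3<K) 3<K eq) (Fin.toℕ<n e)
    from-first : (∃ λ (e : Fin 3) → y ⊕ + toℕ e ≡ x ⊕ + 0) → y ≡ x
    from-first (0F , y≡x)   = ⊕-injectiveˡ (+ 0) y≡x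
    from-first (1F , y+1≡x) =
      let e , eq = window⊆ 2F in ⊥-elim (beyond-window e (trans eq (shift 2 y+1≡x)))
    from-first (2F , y+2≡x) =
      let e , eq = window⊆ 1F in ⊥-elim (beyond-window e (trans eq (shift 1 y+2≡x)))

Fin3<K : ∀ {K} → 3 ℕ.< K → (d : Fin 3) → toℕ d ℕ.< K
Fin3<K 3<K d = ℕ.<-trans (Fin.toℕ<n d) 3<K

module Torus (m n : ℕ) (3<m : 3 ℕ.< m) (3<n : 3 ℕ.< n) where

  instance
    m≢0 : NonZero m
    m≢0 = ℕ.>-nonZero (ℕ.<-trans ℕ.z<s 3<m)
    n≢0 : NonZero n
    n≢0 = ℕ.>-nonZero (ℕ.<-trans ℕ.z<s 3<n)

  Vertex : Set
  Vertex = Fin m × Fin n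

  step : Fin 2 → Vertex → ℤ → Vertex
  step 0F (i , j) d = i ⊕ d , j
  step 1F (i , j) d = i , j ⊕ d

  step-inverse : ∀ τ b d v → step τ b d ≡ v ⇔ step τ v (ℤ.- d) ≡ b
  step-inverse 0F (i , j) d (i' , j') = mk⇔
    (λ eq → cong₂ _,_ (Equivalence.to   (⊕-inverse i d i') (,-injectiveˡ eq)) (sym (,-injectiveʳ eq)))
    (λ eq → cong₂ _,_ (Equivalence.from (⊕-inverse i d i') (,-injectiveˡ eq)) (sym (,-injectiveʳ eq)))
  step-inverse 1F (i , j) d (i' , j') = mk⇔
    (λ eq → cong₂ _,_ (sym (,-injectiveˡ eq)) (Equivalence.to   (⊕-inverse j d j') (,-injectiveʳ eq)))
    (λ eq → cong₂ _,_ (sym (,-injectiveˡ eq)) (Equivalence.from (⊕-inverse j d j') (,-injectiveʳ eq)))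

  step-injective⁺ : ∀ τ v {d d' : Fin 3} → step τ v (+ toℕ d) ≡ step τ v (+ toℕ d') → d ≡ d'
  step-injective⁺ 0F (i , j) {d} {d'} eq =
    Fin.toℕ-injective (⊕-injectiveʳ i (Fin3<K 3<m d) (Fin3<K 3<m d') (,-injectiveˡ eq))
  step-injective⁺ 1F (i , j) {d} {d'} eq =
    Fin.toℕ-injective (⊕-injectiveʳ j (Fin3<K 3<n d) (Fin3<K 3<n d') (,-injectiveʳ eq))

  step-injective⁻ : ∀ τ v {d d' : Fin 3} →
    step τ v (ℤ.- + toℕ d) ≡ step τ v (ℤ.- + toℕ d') → d ≡ d'
  step-injective⁻ 0F (i , j) {d} {d'} eq =
    Fin.toℕ-injective (⊕-injectiveʳ⁻ i (Fin3<K 3<m d) (Fin3<K 3<m d') (,-injectiveˡ eq))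
  step-injective⁻ 1F (i , j) {d} {d'} eq =
    Fin.toℕ-injective (⊕-injectiveʳ⁻ j (Fin3<K 3<n d) (Fin3<K 3<n d') (,-injectiveʳ eq))

  triple : Fin 2 × Vertex → Fin 3 → Vertex
  triple (τ , b) d = step τ b (+ toℕ d)

  triple-determines : ∀ {e e'} → (∀ d → ∃ λ d' → triple e' d' ≡ triple e d) → e ≡ e'
  triple-determines {0F , i , j} {0F , i' , j'} window⊆ =
    cong (0F ,_) (cong₂ _,_ (sym (window-determines 3<m (map₂ ,-injectiveˡ ∘ window⊆)))
                            (sym (,-injectiveʳ (proj₂ (window⊆ 0F)))))
  triple-determines {1F , i , j} {1F , i' , j'} window⊆ =
    cong (1F ,_) (cong₂ _,_ (sym (,-injectiveˡ (proj₂ (window⊆ 0F))))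
                            (sym (window-determines 3<n (map₂ ,-injectiveʳ ∘ window⊆))))
  triple-determines {0F , i , j} {1F , i' , j'} window⊆ = ⊥-elim (ℕ.0≢1+n
    (⊕-injectiveʳ i (Fin3<K 3<m 0F) (Fin3<K 3<m 1F)
      (trans (sym (,-injectiveˡ (proj₂ (window⊆ 0F)))) (,-injectiveˡ (proj₂ (window⊆ 1F))))))
  triple-determines {1F , i , j} {0F , i' , j'} window⊆ = ⊥-elim (ℕ.0≢1+n
    (⊕-injectiveʳ j (Fin3<K 3<n 0F) (Fin3<K 3<n 1F)
      (trans (sym (,-injectiveʳ (proj₂ (window⊆ 0F)))) (,-injectiveʳ (proj₂ (window⊆ 1F))))))

  containing : Vertex → Fin 2 × Fin 3 → Fin 2 × Vertex
  containing v (τ , d) = τ , step τ v (ℤ.- + toℕ d)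

  containing-injective : ∀ v → Injective _≡_ _≡_ (containing v)
  containing-injective v {τ , d} {τ' , d'} eq with ,-injectiveˡ eq
  ... | refl = cong (τ ,_) (step-injective⁻ τ v (,-injectiveʳ eq))

  degree : ∀ v → Exactly 6 (λ e → ∃ λ d → triple e d ≡ v)
  degree v = Exactly-cong containing⇔∈
    (Exactly-image (↔-sym Fin.*↔×) (containing v) (containing-injective v))
    where
    containing⇔∈ : ∀ e → (∃ λ c → containing v c ≡ e) ⇔ (∃ λ d → triple e d ≡ v)
    containing⇔∈ (τ , b) = mk⇔
      (λ { ((τ , d) , refl) → d , Equivalence.from (step-inverse τ _ (+ toℕ d) v) refl })
      (λ (d , eq) → (τ , d) , cong (τ ,_) (Equivalence.to (step-inverse τ b (+ toℕ d) v) eq))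

  torus : TripleSystem Vertex (Fin 2 × Vertex)
  torus = record
    { triple            = triple
    ; triple-injective  = λ (τ , b) → step-injective⁺ τ b
    ; triple-determines = triple-determines
    ; degree            = degree
    }

  vertexCode : Vertex → ℕ
  vertexCode = toℕ ∘ Inverse.from Fin.*↔×

  vertexCode-injective : Injective _≡_ _≡_ vertexCode
  vertexCode-injective = from-injective Fin.*↔× ∘ Fin.toℕ-injective

  siteIndex : Fin (2 ℕ.* m ℕ.* n) ↔ (Fin 2 × Vertex)
  siteIndex = ↔-trans Fin.*↔× (↔-trans (×-cong Fin.*↔× ↔-refl) Σ-assoc)

open import Data.Nat using (_≤_; _*_)
open import Data.Nat.Divisibility using (_∣_)

mainTheorem2 : (R : RealField) → (m n : ℕ) → 4 ≤ m → 4 ≤ n → 2 ∣ m → 2 ∣ n →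
    PointConicConfiguration R (2 * m * n) 6
mainTheorem2 R m n 4≤m 4≤n _ _ =
  Realisation.configuration R torus vertexCode vertexCode-injective siteIndex siteIndex
  where open Torus m n 4≤m 4≤n
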